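{- Let $A,B,C$ be simple types, let $M$ be a closed $\lambda$-term of type $A\times B\Rightarrow C$, and let $L_C\subseteq\mathrm{Tm}(C)$ be a regular language. For regular languages $L_A\subseteq\mathrm{Tm}(A)$ and $L_B\subseteq\mathrm{Tm}(B)$ define $$L_A\backslash L_C=\{\,N_B\in\mathrm{Tm}(B)\mid \forall N_A\in L_A,\ M\,(N_A,N_B)\in L_C\,\},$$ $$L_C/ L_B=\{\,N_A\in\mathrm{Tm}(A)\mid \forall N_B\in L_B,\ M\,(N_A,N_B)\in L_C\,\}.$$ Then $L_A\backslash L_C$ and $L_C/L_B$ are regular, and the maps $L_A\mapsto L_A\backslash L_C$ from $\mathrm{Reg}(A)$ to $\mathrm{Reg}(B)^{\mathrm{op}}$ and $L_B\mapsto L_C/L_B$ from $\mathrm{Reg}(B)^{\mathrm{op}}$ to $\mathrm{Reg}(A)$ form an adjunction (left adjoint the former), i.e. for all $L_A\in\mathrm{Reg}(A)$ and $L_B\in\mathrm{Reg}(B)$: $L_B\subseteq L_A\backslash L_C$ if and only if $L_A\subseteq L_C/L_B$.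
   Context: Simple types: $A,B::=A\times B\mid A\Rightarrow B\mid 1\mid o$. $\mathrm{Tm}(A)$: closed simply-typed $\lambda$-terms (with pairs, projections, unit) of type $A$ modulo $\beta\eta$. For a finite set $Q$, $[\![-]\!]_Q$ is the standard interpretation in finite sets with $[\![o]\!]_Q=Q$. $L\subseteq\mathrm{Tm}(A)$ is $Q$-regular if $L=\{N\mid[\![N]\!]_Q\in F\}$ for some $F\subseteq[\![A]\!]_Q$, and regular if $Q$-regular for some finite $Q$. $\mathrm{Reg}(A)$ is the set of regular languages of type $A$ ordered by inclusion. -}

module Defs where

open import Data.Nat using (ℕ)
open import Data.Fin using (Fin)
open import Data.Unit using (⊤; tt)
open import Data.Product using (Σ; _×_; _,_; proj₁; proj₂)
open import Data.List using (List; []; _∷_)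
open import Function.Bundles using (_⇔_)
open import Level using (Level; 0ℓ) renaming (suc to lsuc)

infixr 7 _⇒_
infixr 8 _⊗_
data Ty : Set where
  _⊗_ : Ty → Ty → Ty
  _⇒_ : Ty → Ty → Ty
  𝟙   : Ty
  o   : Ty

Ctx : Set
Ctx = List Ty

data _∋_ : Ctx → Ty → Set where
  here  : ∀ {Γ A} → (A ∷ Γ) ∋ A
  there : ∀ {Γ A B} → Γ ∋ A → (B ∷ Γ) ∋ A

data Term (Γ : Ctx) : Ty → Set where
  var   : ∀ {A} → Γ ∋ A → Term Γ A
  lam   : ∀ {A B} → Term (A ∷ Γ) B → Term Γ (A ⇒ B)
  app   : ∀ {A B} → Term Γ (A ⇒ B) → Term Γ A → Term Γ B
  pair  : ∀ {A B} → Term Γ A → Term Γ B → Term Γ (A ⊗ B)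
  fst   : ∀ {A B} → Term Γ (A ⊗ B) → Term Γ A
  snd   : ∀ {A B} → Term Γ (A ⊗ B) → Term Γ B
  unit  : Term Γ 𝟙

Tm : Ty → Set
Tm A = Term [] A

⟦_⟧ty : Ty → Set → Set
⟦ A ⊗ B ⟧ty Q = ⟦ A ⟧ty Q × ⟦ B ⟧ty Q
⟦ A ⇒ B ⟧ty Q = ⟦ A ⟧ty Q → ⟦ B ⟧ty Q
⟦ 𝟙 ⟧ty Q = ⊤
⟦ o ⟧ty Q = Q

data Env (Q : Set) : Ctx → Set where
  []  : Env Q []
  _∷_ : ∀ {Γ A} → ⟦ A ⟧ty Q → Env Q Γ → Env Q (A ∷ Γ)

lookupEnv : ∀ {Q Γ A} → Env Q Γ → Γ ∋ A → ⟦ A ⟧ty Q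
lookupEnv (v ∷ ρ) here = v
lookupEnv (v ∷ ρ) (there x) = lookupEnv ρ x

evalTerm : ∀ {Q Γ A} → Term Γ A → Env Q Γ → ⟦ A ⟧ty Q
evalTerm (var x) ρ = lookupEnv ρ x
evalTerm (lam t) ρ = λ v → evalTerm t (v ∷ ρ)
evalTerm (app t u) ρ = evalTerm t ρ (evalTerm u ρ)
evalTerm (pair t u) ρ = evalTerm t ρ , evalTerm u ρ
evalTerm (fst t) ρ = proj₁ (evalTerm t ρ)
evalTerm (snd t) ρ = proj₂ (evalTerm t ρ)
evalTerm unit ρ = tt

⟦_⟧ : ∀ {A} → Tm A → (n : ℕ) → ⟦ A ⟧ty (Fin n)
⟦ N ⟧ n = evalTerm N []

Lang : Ty → Set₁
Lang A = Tm A → Set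

_⊆_ : ∀ {A} → Lang A → Lang A → Set
L ⊆ L' = ∀ N → L N → L' N

IsRegularFor : ∀ {A} → ℕ → Lang A → Set₁
IsRegularFor {A} n L = Σ (⟦ A ⟧ty (Fin n) → Set) λ F → ∀ N → L N ⇔ F (⟦ N ⟧ n)

IsRegular : ∀ {A} → Lang A → Set₁
IsRegular L = Σ ℕ λ n → IsRegularFor n L

leftRes : ∀ {A B C} → Tm (A ⊗ B ⇒ C) → Lang A → Lang C → Lang B
leftRes M LA LC NB = ∀ NA → LA NA → LC (app M (pair NA NB))

rightRes : ∀ {A B C} → Tm (A ⊗ B ⇒ C) → Lang C → Lang B → Lang A
rightRes M LC LB NA = ∀ NB → LB NB → LC (app M (pair NA NB))

-- Membership of M (N_A , N_B) in L_C depends only on the semantics of N_A and N_B, so each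
-- residual is an intersection of inverse images of L_C along maps that commute with the
-- interpretation; Q-regular languages are closed under both, for the same Q. Hence the
-- residuals are regular whatever L_A and L_B are, and the adjunction is the symmetry of
-- the two-variable quantifier ∀ N_A ∈ L_A. ∀ N_B ∈ L_B. M (N_A , N_B) ∈ L_C.
module Submission where

open import Defs
open import Data.Nat using (ℕ)
open import Data.Fin using (Fin)
open import Data.Product using (_×_; _,_; proj₁; proj₂)
open import Function using (_∘_)
open import Function.Bundles using (_⇔_; mk⇔; module Equivalence)
open import Relation.Binary.PropositionalEquality using (_≡_; refl; subst; sym)

open Equivalence using (to; from)

private
  variable
    A B C : Ty
    n : ℕ

regularFor-⋂ : {I : Set} (P : I → Set) (L : I → Lang A) → (∀ i → IsRegularFor n (L i)) →
               IsRegularFor n (λ N → ∀ i → P i → L i N)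
regularFor-⋂ P L reg =
  (λ v → ∀ i → P i → proj₁ (reg i) v) ,
  λ N → mk⇔ (λ N∈L i i∈P → to (proj₂ (reg i) N) (N∈L i i∈P))
            (λ ⟦N⟧∈F i i∈P → from (proj₂ (reg i) N) (⟦N⟧∈F i i∈P))

regularFor-preimage : (f : Tm B → Tm C) (g : ⟦ B ⟧ty (Fin n) → ⟦ C ⟧ty (Fin n)) →
                      (∀ N → ⟦ f N ⟧ n ≡ g (⟦ N ⟧ n)) →
                      {LC : Lang C} → IsRegularFor n LC → IsRegularFor n (LC ∘ f)
regularFor-preimage f g ⟦f⟧≡g (F , LC⇔F) =
  F ∘ g , λ N → mk⇔ (subst F (⟦f⟧≡g N) ∘ to (LC⇔F (f N)))
                    (from (LC⇔F (f N)) ∘ subst F (sym (⟦f⟧≡g N)))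

module _ (M : Tm (A ⊗ B ⇒ C)) {LC : Lang C} (LC-reg : IsRegularFor n LC) where

  leftRes-regularFor : (LA : Lang A) → IsRegularFor n (leftRes M LA LC)
  leftRes-regularFor LA = regularFor-⋂ LA _ λ NA →
    regularFor-preimage (λ NB → app M (pair NA NB))
                        (λ v → ⟦ M ⟧ n (⟦ NA ⟧ n , v)) (λ _ → refl) LC-reg

  rightRes-regularFor : (LB : Lang B) → IsRegularFor n (rightRes M LC LB)
  rightRes-regularFor LB = regularFor-⋂ LB _ λ NB →
    regularFor-preimage (λ NA → app M (pair NA NB))
                        (λ v → ⟦ M ⟧ n (v , ⟦ NB ⟧ n)) (λ _ → refl) LC-reg

leftRes⊣rightRes : (M : Tm (A ⊗ B ⇒ C)) (LA : Lang A) (LB : Lang B) (LC : Lang C) →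
                   (LB ⊆ leftRes M LA LC) ⇔ (LA ⊆ rightRes M LC LB)
leftRes⊣rightRes M LA LB LC =
  mk⇔ (λ p NA NA∈LA NB NB∈LB → p NB NB∈LB NA NA∈LA)
      (λ p NB NB∈LB NA NA∈LA → p NA NA∈LA NB NB∈LB)

theorem7p1 : (A B C : Ty) (M : Tm (A ⊗ B ⇒ C)) (LC : Lang C) → IsRegular LC →
    ((LA : Lang A) → IsRegular LA → IsRegular (leftRes M LA LC))
    × ((LB : Lang B) → IsRegular LB → IsRegular (rightRes M LC LB))
    × ((LA : Lang A) (LB : Lang B) → IsRegular LA → IsRegular LB →
        (LB ⊆ leftRes M LA LC) ⇔ (LA ⊆ rightRes M LC LB))
theorem7p1 A B C M LC (n , LC-reg) =
    (λ LA _ → n , leftRes-regularFor M LC-reg LA)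
  , (λ LB _ → n , rightRes-regularFor M LC-reg LB)
  , (λ LA LB _ _ → leftRes⊣rightRes M LA LB LC)
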